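{- Let $l\ge1$ and $C\ge1$ be integers and let $\phi_{(l,C)}$ be the propositional formula defined below. Then $\phi_{(l,C)}$ is satisfiable if and only if there exists a sequence $x_1,\dots,x_l\in\{+1,-1\}$ of length $l$ with discrepancy at most $C$. Moreover, for every satisfying assignment of $\phi_{(l,C)}$, the sequence defined by $x_i=+1$ if $p_i$ is true and $x_i=-1$ if $p_i$ is false ($1\le i\le l$) has discrepancy at most $C$.
   Context: For a finite sequence $x_1,\dots,x_l\in\{+1,-1\}$, its discrepancy is $\max\{|\sum_{i=1}^{k}x_{id}| : d,k\ge1,\ kd\le l\}$. Let $D=\lfloor l/(C+1)\rfloor$. Propositional variables: $p_1,\dots,p_l$; $B$; and $s^{(i,d)}_j$ for $1\le d\le D$, $1\le i\le\lfloor l/d\rfloor+1$, $-C\le j\le C$. For $1\le d\le D$ let $\phi_{(l,C,d)} = s_0^{(1,d)}\wedge\bigwedge_{i=1}^{\lfloor l/d\rfloor}\Big[\bigwedge_{ -C\le j<C}(s_j^{(i,d)}\wedge p_{id}\to s_{j+1}^{(i+1,d)})\wedge\bigwedge_{ -C<j\le C}(s_j^{(i,d)}\wedge\neg p_{id}\to s_{j-1}^{(i+1,d)})\wedge(s_C^{(i,d)}\wedge p_{id}\to B)\wedge(s_{ -C}^{(i,d)}\wedge\neg p_{id}\to B)\Big]$. Let $\mathsf{frame}_{(l,C)}$ be the conjunction, over all $1\le d\le D$ and $1\le i\le\lfloor l/d\rfloor$, of a formula expressing that exactly one of $s^{(i,d)}_{ -C},\dots,s^{(i,d)}_{C}$ is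 true. Finally $\phi_{(l,C)}=\neg B\wedge\bigwedge_{d=1}^{D}\phi_{(l,C,d)}\wedge\mathsf{frame}_{(l,C)}$. -}

module Defs where

open import Data.Nat as ℕ using (ℕ; zero; suc; _≡ᵇ_; _/_)
open import Data.Integer as ℤ using (ℤ; +_; -_; ∣_∣)
open import Data.Bool using (Bool; true; false; if_then_else_; _∧_; _∨_; not)
open import Data.List using (List; []; _∷_; map; upTo; foldr)
open import Data.Product using (Σ; _×_)
open import Relation.Binary.PropositionalEquality using (_≡_)

-- ±1 sequences and discrepancy
-- A sequence x₁,…,x_l is modelled as a function ℕ → ℤ; only the values
-- at positions 1..l matter.

IsPMSeq : ℕ → (ℕ → ℤ) → Set
IsPMSeq l x = ∀ i → 1 ℕ.≤ i → i ℕ.≤ l → (x i ≡ ℤ.+ 1) Data.Sum.⊎ (x i ≡ ℤ.- (ℤ.+ 1))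
  where import Data.Sum

partialSum : (ℕ → ℤ) → ℕ → ℕ → ℤ
partialSum x d zero    = + 0
partialSum x d (suc k) = partialSum x d k ℤ.+ x (suc k ℕ.* d)

DiscAtMost : ℕ → ℕ → (ℕ → ℤ) → Set
DiscAtMost l C x =
  ∀ d k → 1 ℕ.≤ d → 1 ℕ.≤ k → k ℕ.* d ℕ.≤ l → ∣ partialSum x d k ∣ ℕ.≤ C

-- variables: p i, B, and s^{(i,d)}_j written s i d j
data Var : Set where
  p : ℕ → Var
  B : Var
  s : ℕ → ℕ → ℤ → Var

data Formula : Set where
  ⊤ᶠ   : Formula
  var  : Var → Formula
  ¬ᶠ_  : Formula → Formula
  _∧ᶠ_ : Formula → Formula → Formula
  _∨ᶠ_ : Formula → Formula → Formula
  _⇒ᶠ_ : Formula → Formula → Formula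

infixr 4 _⇒ᶠ_
infixr 5 _∨ᶠ_
infixr 6 _∧ᶠ_
infix  7 ¬ᶠ_

Assignment : Set
Assignment = Var → Bool

⟦_⟧ : Formula → Assignment → Bool
⟦ ⊤ᶠ ⟧     σ = true
⟦ var v ⟧  σ = σ v
⟦ ¬ᶠ φ ⟧   σ = not (⟦ φ ⟧ σ)
⟦ φ ∧ᶠ ψ ⟧ σ = ⟦ φ ⟧ σ ∧ ⟦ ψ ⟧ σ
⟦ φ ∨ᶠ ψ ⟧ σ = ⟦ φ ⟧ σ ∨ ⟦ ψ ⟧ σ
⟦ φ ⇒ᶠ ψ ⟧ σ = not (⟦ φ ⟧ σ) ∨ ⟦ ψ ⟧ σ

Satisfiable : Formula → Set
Satisfiable φ = Σ Assignment λ σ → ⟦ φ ⟧ σ ≡ true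

⋀ : List Formula → Formula
⋀ = foldr _∧ᶠ_ ⊤ᶠ

⋁ : List Formula → Formula
⋁ = foldr _∨ᶠ_ (¬ᶠ ⊤ᶠ)

rangeℕ : ℕ → ℕ → List ℕ
rangeℕ a n = map (a ℕ.+_) (upTo n)

allJ : ℕ → List ℤ
allJ C = map (λ n → + n ℤ.- + C) (upTo (suc (2 ℕ.* C)))

lowJ : ℕ → List ℤ
lowJ C = map (λ n → + n ℤ.- + C) (upTo (2 ℕ.* C))

highJ : ℕ → List ℤ
highJ C = map (λ n → + suc n ℤ.- + C) (upTo (2 ℕ.* C))

sv : ℕ → ℕ → ℤ → Formula
sv i d j = var (s i d j)

pv : ℕ → Formula
pv i = var (p i)

Bv : Formula
Bv = var B

φd : ℕ → ℕ → ℕ → Formula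
φd l C d' =
  sv 1 d (+ 0) ∧ᶠ
  ⋀ (map step (rangeℕ 1 (l / d)))
  where
  d = suc d'
  step : ℕ → Formula
  step i =
    ⋀ (map (λ j → (sv i d j ∧ᶠ pv (i ℕ.* d)) ⇒ᶠ sv (suc i) d (j ℤ.+ + 1)) (lowJ C)) ∧ᶠ
    ⋀ (map (λ j → (sv i d j ∧ᶠ ¬ᶠ pv (i ℕ.* d)) ⇒ᶠ sv (suc i) d (j ℤ.- + 1)) (highJ C)) ∧ᶠ
    ((sv i d (+ C) ∧ᶠ pv (i ℕ.* d)) ⇒ᶠ Bv) ∧ᶠ
    ((sv i d (- + C) ∧ᶠ ¬ᶠ pv (i ℕ.* d)) ⇒ᶠ Bv)

exactlyOne : ℕ → ℕ → ℕ → Formula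
exactlyOne C i d =
  ⋁ (map (sv i d) (allJ C)) ∧ᶠ
  ⋀ (map (λ n → ⋀ (map (λ m → pair n m) (upTo (suc (2 ℕ.* C))))) (upTo (suc (2 ℕ.* C))))
  where
  j : ℕ → ℤ
  j n = + n ℤ.- + C
  pair : ℕ → ℕ → Formula
  pair n m = if n ≡ᵇ m then ⊤ᶠ else ¬ᶠ (sv i d (j n) ∧ᶠ sv i d (j m))

D : ℕ → ℕ → ℕ
D l C = l / suc C

frame : ℕ → ℕ → Formula
frame l C =
  ⋀ (map (λ d' → ⋀ (map (λ i → exactlyOne C i (suc d')) (rangeℕ 1 (l / suc d'))))
         (upTo (D l C)))

φ : ℕ → ℕ → Formula
φ l C = ¬ᶠ Bv ∧ᶠ ⋀ (map (φd l C) (upTo (D l C))) ∧ᶠ frame l C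

seqOf : Assignment → ℕ → ℤ
seqOf σ i = if σ (p i) then + 1 else - (+ 1)

module Submission where

-- The formula φ_(l,C) simulates, for every step length d ≤ D = ⌊l/(C+1)⌋,
-- a counter automaton reading x_d, x_{2d}, … : the variable s^{(i,d)}_j
-- says "after i-1 steps the partial sum is j", and B is the error state
-- reached when the counter would leave [-C, C].
--
-- Soundness: along a satisfying assignment the counter at position i
-- always holds the true partial sum (an induction whose step is the lemma
-- 'transition'), and since ¬B holds it never leaves [-C, C].  For d > D
-- at most C steps fit into [1, l], so |S_k| ≤ k ≤ C trivially.
-- Completeness: from a sequence of discrepancy ≤ C we build the canonical
-- assignment, making s^{(i,d)}_j true exactly when j is the partial sum.

open import Defs
open import Data.Nat using (ℕ; _≤_)
open import Data.Integer using (ℤ)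
open import Data.Product using (Σ; _×_)
open import Function.Bundles using (_⇔_)
open import Relation.Binary.PropositionalEquality using (_≡_)
open import Data.Bool using (true)

open import Data.Nat as ℕ using (zero; suc; _<_; z≤n; s≤s; _∸_; _≡ᵇ_; _<?_)
import Data.Nat.Properties as ℕP
open import Data.Nat.DivMod using (_/_; m*n/n≡m; /-monoˡ-≤; m/n*n≤m)
open import Data.Integer as ℤ using (+_; -_; ∣_∣; -[1+_])
import Data.Integer.Properties as ℤP
open import Data.Integer.Tactic.RingSolver using (solve-∀)
open import Data.Bool using (false; not; T; if_then_else_)
open import Data.Bool.Properties using (∧-conicalˡ; ∧-conicalʳ; ∨-zeroʳ)
open import Data.List using (List; []; _∷_; map; upTo)
open import Data.List.Membership.Propositional using (_∈_)
open import Data.List.Membership.Propositional.Properties using (∈-map⁺; ∈-map⁻; ∈-upTo⁺; ∈-upTo⁻)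
open import Data.List.Relation.Unary.Any using (here; there)
open import Data.Product using (_,_; proj₁; proj₂)
open import Data.Sum using (inj₁; inj₂)
open import Data.Empty using (⊥; ⊥-elim)
open import Relation.Nullary using (Dec; yes; no; does)
open import Relation.Nullary.Decidable using (dec-true)
open import Relation.Binary.PropositionalEquality using (refl; sym; trans; cong; cong₂; subst; module ≡-Reasoning)
open import Function.Bundles using (mk⇔)

_⊨_ : Assignment → Formula → Set
σ ⊨ ψ = ⟦ ψ ⟧ σ ≡ true

infix 3 _⊨_

true≢false : true ≡ false → ⊥
true≢false ()

module Rules (σ : Assignment) where

  ⊨-∧ : ∀ ψ χ → σ ⊨ ψ ∧ᶠ χ → σ ⊨ ψ × σ ⊨ χ
  ⊨-∧ ψ χ h = ∧-conicalˡ (⟦ ψ ⟧ σ) _ h , ∧-conicalʳ (⟦ ψ ⟧ σ) _ h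

  ∧-intro : ∀ ψ χ → σ ⊨ ψ → σ ⊨ χ → σ ⊨ ψ ∧ᶠ χ
  ∧-intro ψ χ hψ hχ rewrite hψ | hχ = refl

  ⊨-⇒ : ∀ ψ χ → σ ⊨ ψ ⇒ᶠ χ → σ ⊨ ψ → σ ⊨ χ
  ⊨-⇒ ψ χ h hψ with ⟦ ψ ⟧ σ
  ... | true = h

  ⇒-intro : ∀ ψ χ → (σ ⊨ ψ → σ ⊨ χ) → σ ⊨ ψ ⇒ᶠ χ
  ⇒-intro ψ χ f with ⟦ ψ ⟧ σ
  ... | true  = f refl
  ... | false = refl

  ⊨-¬ : ∀ ψ → σ ⊨ ¬ᶠ ψ → ⟦ ψ ⟧ σ ≡ false
  ⊨-¬ ψ h with ⟦ ψ ⟧ σ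
  ⊨-¬ ψ () | true
  ... | false = refl

  ¬-intro : ∀ ψ → (σ ⊨ ψ → ⊥) → σ ⊨ ¬ᶠ ψ
  ¬-intro ψ f with ⟦ ψ ⟧ σ
  ... | true  = ⊥-elim (f refl)
  ... | false = refl

  ⋀-elim : ∀ {A : Set} (f : A → Formula) {xs : List A} {a} →
    σ ⊨ ⋀ (map f xs) → a ∈ xs → σ ⊨ f a
  ⋀-elim f {y ∷ ys} h (here refl)  = proj₁ (⊨-∧ (f y) (⋀ (map f ys)) h)
  ⋀-elim f {y ∷ ys} h (there a∈ys) = ⋀-elim f (proj₂ (⊨-∧ (f y) (⋀ (map f ys)) h)) a∈ys

  ⋀-intro : ∀ {A : Set} (f : A → Formula) (xs : List A) →
    (∀ {a} → a ∈ xs → σ ⊨ f a) → σ ⊨ ⋀ (map f xs)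
  ⋀-intro f []       all = refl
  ⋀-intro f (y ∷ ys) all =
    ∧-intro (f y) (⋀ (map f ys)) (all (here refl)) (⋀-intro f ys (λ a∈ys → all (there a∈ys)))

  ⋁-intro : ∀ {A : Set} (f : A → Formula) (xs : List A) {a} →
    a ∈ xs → σ ⊨ f a → σ ⊨ ⋁ (map f xs)
  ⋁-intro f (y ∷ ys) (here refl) h rewrite h = refl
  ⋁-intro f (y ∷ ys) (there a∈ys) h rewrite ⋁-intro f ys a∈ys h = ∨-zeroʳ (⟦ f y ⟧ σ)

∈-range⁺ : ∀ {k n} → k < n → suc k ∈ rangeℕ 1 n
∈-range⁺ k<n = ∈-map⁺ (1 ℕ.+_) (∈-upTo⁺ k<n)

∈-range-elim : ∀ {n} (P : ℕ → Set) → (∀ k → k < n → P (suc k)) →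
  ∀ {i} → i ∈ rangeℕ 1 n → P i
∈-range-elim P f i∈ with ∈-map⁻ (1 ℕ.+_) i∈
... | k , k∈ , refl = f k (∈-upTo⁻ k∈)

-- Counter values j ∈ [-C, C] are encoded as j = n - C with n ∈ [0, 2C];
-- the lists allJ, lowJ, highJ of Defs are images of ranges under this map.

offset : ℕ → ℕ → ℤ
offset C n = + n ℤ.- + C

two*C : ∀ C → 2 ℕ.* C ≡ C ℕ.+ C
two*C C = cong (C ℕ.+_) (ℕP.+-identityʳ C)

sub-add-cancel : ∀ a c → (a ℤ.- c) ℤ.+ c ≡ a
sub-add-cancel = solve-∀

add-sub-cancel : ∀ a c → (a ℤ.+ c) ℤ.- c ≡ a
add-sub-cancel = solve-∀

offset-injective : ∀ C {n m} → offset C n ≡ offset C m → n ≡ m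
offset-injective C {n} {m} e = ℤP.+-injective (begin
  + n                     ≡⟨ sym (sub-add-cancel (+ n) (+ C)) ⟩
  offset C n ℤ.+ + C      ≡⟨ cong (ℤ._+ + C) e ⟩
  offset C m ℤ.+ + C      ≡⟨ sub-add-cancel (+ m) (+ C) ⟩
  + m                     ∎)
  where open ≡-Reasoning

offset-suc : ∀ C n → offset C n ℤ.+ + 1 ≡ offset C (suc n)
offset-suc C n = shift (+ n) (+ C)
  where
  shift : ∀ a c → (a ℤ.- c) ℤ.+ + 1 ≡ (+ 1 ℤ.+ a) ℤ.- c
  shift = solve-∀

offset-pred : ∀ C n → offset C (suc n) ℤ.- + 1 ≡ offset C n
offset-pred C n = unshift (+ n) (+ C)
  where
  unshift : ∀ a c → ((+ 1 ℤ.+ a) ℤ.- c) ℤ.- + 1 ≡ a ℤ.- c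
  unshift = solve-∀

offset-zero : ∀ C → offset C C ≡ + 0
offset-zero C = ℤP.+-inverseʳ (+ C)

offset-bottom : ∀ C → offset C 0 ≡ - + C
offset-bottom C = ℤP.+-identityˡ (- + C)

offset-top : ∀ C → offset C (2 ℕ.* C) ≡ + C
offset-top C rewrite two*C C = add-sub-cancel (+ C) (+ C)

∣offset∣≤ : ∀ C {n} → n ≤ 2 ℕ.* C → ∣ offset C n ∣ ≤ C
∣offset∣≤ C {n} n≤2C rewrite ℤP.[+m]-[+n]≡m⊖n n C with ℕP.≤-total n C
... | inj₁ n≤C = subst (_≤ C) (sym (ℤP.∣⊖∣-≤ n≤C)) (ℕP.m∸n≤m C n)
... | inj₂ C≤n = subst (_≤ C) (sym (trans (ℤP.∣m⊖n∣≡∣n⊖m∣ n C) (ℤP.∣⊖∣-≤ C≤n)))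
                   (ℕP.m≤n+o⇒m∸n≤o n C (subst (n ≤_) (two*C C) n≤2C))

offset-onto : ∀ C z → ∣ z ∣ ≤ C → Σ ℕ λ n → n ≤ 2 ℕ.* C × offset C n ≡ z
offset-onto C (+ a) a≤C =
  a ℕ.+ C ,
  subst (a ℕ.+ C ≤_) (sym (two*C C)) (ℕP.+-monoˡ-≤ C a≤C) ,
  add-sub-cancel (+ a) (+ C)
offset-onto C -[1+ a ] a<C =
  C ∸ suc a ,
  ℕP.≤-trans (ℕP.m∸n≤m C (suc a)) (subst (C ≤_) (sym (two*C C)) (ℕP.m≤m+n C C)) ,
  trans (ℤP.[+m]-[+n]≡m⊖n (C ∸ suc a) C)
        (trans (ℤP.⊖-< below) (cong (λ k → - (+ k)) (ℕP.m∸[m∸n]≡n a<C)))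
  where
  below : C ∸ suc a < C
  below = ℕP.∸-monoʳ-< {C} {suc a} {0} (s≤s z≤n) a<C

∈-allJ : ∀ C {n} → n ≤ 2 ℕ.* C → offset C n ∈ allJ C
∈-allJ C n≤ = ∈-map⁺ (offset C) (∈-upTo⁺ (s≤s n≤))

∈-lowJ : ∀ C {n} → n < 2 ℕ.* C → offset C n ∈ lowJ C
∈-lowJ C n< = ∈-map⁺ (offset C) (∈-upTo⁺ n<)

∈-highJ : ∀ C {n} → n < 2 ℕ.* C → offset C (suc n) ∈ highJ C
∈-highJ C n< = ∈-map⁺ (λ n → offset C (suc n)) (∈-upTo⁺ n<)

≤-/ : ∀ k d l → k ℕ.* suc d ≤ l → k ≤ l / suc d
≤-/ k d l le = subst (_≤ l / suc d) (m*n/n≡m k (suc d)) (/-monoˡ-≤ (suc d) le)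

/-≤ : ∀ k d l → k ≤ l / suc d → k ℕ.* suc d ≤ l
/-≤ k d l le = ℕP.≤-trans (ℕP.*-monoˡ-≤ (suc d) le) (m/n*n≤m l (suc d))

-- For step lengths d > D = ⌊l/(C+1)⌋ at most C steps fit into [1, l];
-- this is why φ_(l,C) only needs automata for d ≤ D.
few-steps : ∀ l C d′ k → D l C ≤ d′ → k ℕ.* suc d′ ≤ l → k ≤ C
few-steps l C d′ k D≤d′ kd≤l = ℕP.≮⇒≥ λ C<k → ℕP.<⇒≱ (d′<D C<k) D≤d′
  where
  d′<D : C < k → d′ < D l C
  d′<D C<k = ≤-/ (suc d′) C l (ℕP.≤-trans
    (ℕP.≤-reflexive (ℕP.*-comm (suc d′) (suc C)))
    (ℕP.≤-trans (ℕP.*-monoˡ-≤ (suc d′) C<k) kd≤l))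

∣partialSum∣≤ : ∀ (x : ℕ → ℤ) → (∀ i → ∣ x i ∣ ≤ 1) → ∀ d k → ∣ partialSum x d k ∣ ≤ k
∣partialSum∣≤ x unit d zero    = z≤n
∣partialSum∣≤ x unit d (suc k) =
  ℕP.≤-trans (ℤP.∣i+j∣≤∣i∣+∣j∣ (partialSum x d k) (x (suc k ℕ.* d)))
    (ℕP.≤-trans (ℕP.+-mono-≤ (∣partialSum∣≤ x unit d k) (unit (suc k ℕ.* d)))
                (ℕP.≤-reflexive (ℕP.+-comm k 1)))

∣seqOf∣≤1 : ∀ σ i → ∣ seqOf σ i ∣ ≤ 1
∣seqOf∣≤1 σ i with σ (p i)
... | true  = ℕP.≤-refl
... | false = ℕP.≤-refl

seqOf-pm : ∀ l σ → IsPMSeq l (seqOf σ)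
seqOf-pm l σ i _ _ with σ (p i)
... | true  = inj₁ refl
... | false = inj₂ refl

beyond-top : ∀ C → ∣ + C ℤ.+ + 1 ∣ ≤ C → ⊥
beyond-top C le = ℕP.1+n≰n (subst (_≤ C) (ℕP.+-comm C 1) le)

beyond-bottom : ∀ C → ∣ - + C ℤ.+ - + 1 ∣ ≤ C → ⊥
beyond-bottom C le = beyond-top C (subst (_≤ C) (begin
  ∣ - + C ℤ.+ - + 1 ∣     ≡⟨ cong ∣_∣ (sym (ℤP.neg-distrib-+ (+ C) (+ 1))) ⟩
  ∣ - (+ C ℤ.+ + 1) ∣     ≡⟨ ℤP.∣-i∣≡∣i∣ (+ C ℤ.+ + 1) ⟩
  ∣ + C ℤ.+ + 1 ∣         ∎) le)
  where open ≡-Reasoning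

-- Named copies of the local formulas of Defs.φd and Defs.exactlyOne; they
-- are definitionally equal to the originals.

countUp countDown upperWall lowerWall : ℕ → ℕ → ℕ → Formula
countUp C i d =
  ⋀ (map (λ j → (sv i d j ∧ᶠ pv (i ℕ.* d)) ⇒ᶠ sv (suc i) d (j ℤ.+ + 1)) (lowJ C))
countDown C i d =
  ⋀ (map (λ j → (sv i d j ∧ᶠ ¬ᶠ pv (i ℕ.* d)) ⇒ᶠ sv (suc i) d (j ℤ.- + 1)) (highJ C))
upperWall C i d = (sv i d (+ C) ∧ᶠ pv (i ℕ.* d)) ⇒ᶠ Bv
lowerWall C i d = (sv i d (- + C) ∧ᶠ ¬ᶠ pv (i ℕ.* d)) ⇒ᶠ Bv

stepF : ℕ → ℕ → ℕ → Formula
stepF C i d = countUp C i d ∧ᶠ countDown C i d ∧ᶠ upperWall C i d ∧ᶠ lowerWall C i d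

atLeastOneF : ℕ → ℕ → ℕ → Formula
atLeastOneF C i d = ⋁ (map (sv i d) (allJ C))

pairF : ℕ → ℕ → ℕ → ℕ → ℕ → Formula
pairF C i d n m = if n ≡ᵇ m then ⊤ᶠ else ¬ᶠ (sv i d (offset C n) ∧ᶠ sv i d (offset C m))

atMostOneF : ℕ → ℕ → ℕ → Formula
atMostOneF C i d =
  ⋀ (map (λ n → ⋀ (map (pairF C i d n) (upTo (suc (2 ℕ.* C))))) (upTo (suc (2 ℕ.* C))))

module Automaton (σ : Assignment) (C i d : ℕ) where
  open Rules σ

  step-clauses : σ ⊨ stepF C i d →
    σ ⊨ countUp C i d × σ ⊨ countDown C i d × σ ⊨ upperWall C i d × σ ⊨ lowerWall C i d
  step-clauses h
    with ⊨-∧ (countUp C i d) (countDown C i d ∧ᶠ upperWall C i d ∧ᶠ lowerWall C i d) h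
  ... | up , h′ with ⊨-∧ (countDown C i d) (upperWall C i d ∧ᶠ lowerWall C i d) h′
  ... | down , h″ with ⊨-∧ (upperWall C i d) (lowerWall C i d) h″
  ... | upper , lower = up , down , upper , lower

  -- Reading +1 moves the counter from offset C n to offset C (suc n); the
  -- upper wall together with ¬B guarantees that this stays in range.
  count-up : ∀ {n} → σ ⊨ countUp C i d → σ ⊨ upperWall C i d →
    σ B ≡ false → σ ⊨ pv (i ℕ.* d) → n ≤ 2 ℕ.* C → σ ⊨ sv i d (offset C n) →
    suc n ≤ 2 ℕ.* C × σ ⊨ sv (suc i) d (offset C (suc n))
  count-up {n} up upper noB pᵢ n≤ counter with ℕP.m≤n⇒m<n∨m≡n n≤
  ... | inj₂ refl = ⊥-elim (true≢false (trans (sym hitsB) noB))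
    where
    hitsB : σ B ≡ true
    hitsB = ⊨-⇒ (sv i d (+ C) ∧ᶠ pv (i ℕ.* d)) Bv upper
              (∧-intro (sv i d (+ C)) (pv (i ℕ.* d))
                (subst (λ j → σ ⊨ sv i d j) (offset-top C) counter) pᵢ)
  ... | inj₁ n<2C = n<2C , subst (λ j → σ ⊨ sv (suc i) d j) (offset-suc C n) moved
    where
    moved : σ ⊨ sv (suc i) d (offset C n ℤ.+ + 1)
    moved = ⊨-⇒ (sv i d (offset C n) ∧ᶠ pv (i ℕ.* d)) (sv (suc i) d (offset C n ℤ.+ + 1))
              (⋀-elim _ up (∈-lowJ C n<2C))
              (∧-intro (sv i d (offset C n)) (pv (i ℕ.* d)) counter pᵢ)

  -- Reading -1 moves the counter from offset C (suc m) to offset C m; the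
  -- lower wall together with ¬B rules out the counter being at -C.
  count-down : ∀ {n} → σ ⊨ countDown C i d → σ ⊨ lowerWall C i d →
    σ B ≡ false → σ ⊨ ¬ᶠ pv (i ℕ.* d) → n ≤ 2 ℕ.* C → σ ⊨ sv i d (offset C n) →
    Σ ℕ λ m → n ≡ suc m × σ ⊨ sv (suc i) d (offset C m)
  count-down {zero} _ lower noB ¬pᵢ _ counter =
    ⊥-elim (true≢false (trans (sym hitsB) noB))
    where
    hitsB : σ B ≡ true
    hitsB = ⊨-⇒ (sv i d (- + C) ∧ᶠ ¬ᶠ pv (i ℕ.* d)) Bv lower
              (∧-intro (sv i d (- + C)) (¬ᶠ pv (i ℕ.* d))
                (subst (λ j → σ ⊨ sv i d j) (offset-bottom C) counter) ¬pᵢ)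
  count-down {suc m} down _ _ ¬pᵢ m<2C counter =
    m , refl , subst (λ j → σ ⊨ sv (suc i) d j) (offset-pred C m) moved
    where
    moved : σ ⊨ sv (suc i) d (offset C (suc m) ℤ.- + 1)
    moved = ⊨-⇒ (sv i d (offset C (suc m)) ∧ᶠ ¬ᶠ pv (i ℕ.* d))
              (sv (suc i) d (offset C (suc m) ℤ.- + 1))
              (⋀-elim _ down (∈-highJ C m<2C))
              (∧-intro (sv i d (offset C (suc m))) (¬ᶠ pv (i ℕ.* d)) counter ¬pᵢ)

  transition : ∀ {n} → σ ⊨ stepF C i d → σ B ≡ false → n ≤ 2 ℕ.* C →
    σ ⊨ sv i d (offset C n) →
    Σ ℕ λ n′ → n′ ≤ 2 ℕ.* C × σ ⊨ sv (suc i) d (offset C n′)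
             × offset C n ℤ.+ seqOf σ (i ℕ.* d) ≡ offset C n′
  transition {n} step noB n≤ counter with step-clauses step | σ (p (i ℕ.* d)) in pᵢ
  ... | up , _ , upper , _ | true with count-up up upper noB pᵢ n≤ counter
  ...   | n<2C , moved = suc n , n<2C , moved , offset-suc C n
  transition {n} step noB n≤ counter | _ , down , _ , lower | false
    with count-down down lower noB (cong not pᵢ) n≤ counter
  ... | m , refl , moved = m , ℕP.<⇒≤ n≤ , moved , offset-pred C m

module Soundness (l C : ℕ) (σ : Assignment) (σ⊨φ : σ ⊨ φ l C) where
  open Rules σ

  x : ℕ → ℤ
  x = seqOf σ

  -- φ_(l,C) asserts ¬B and the automata for all d ≤ D.
  automata : σ ⊨ ¬ᶠ Bv × σ ⊨ ⋀ (map (φd l C) (upTo (D l C)))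
  automata =
    let ¬B , rest = ⊨-∧ (¬ᶠ Bv) (⋀ (map (φd l C) (upTo (D l C))) ∧ᶠ frame l C) σ⊨φ
    in ¬B , proj₁ (⊨-∧ (⋀ (map (φd l C) (upTo (D l C)))) (frame l C) rest)

  B-false : σ B ≡ false
  B-false = ⊨-¬ Bv (proj₁ automata)

  automaton-holds : ∀ {d′} → d′ < D l C → σ ⊨ φd l C d′
  automaton-holds d′<D = ⋀-elim (φd l C) (proj₂ automata) (∈-upTo⁺ d′<D)

  automaton-parts : ∀ {d′} → σ ⊨ φd l C d′ →
    σ ⊨ sv 1 (suc d′) (+ 0) × (∀ k → k < l / suc d′ → σ ⊨ stepF C (suc k) (suc d′))
  automaton-parts {d′} h with ⊨-∧ (sv 1 (suc d′) (+ 0))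
                                 (⋀ (map (λ i → stepF C i (suc d′)) (rangeℕ 1 (l / suc d′)))) h
  ... | start , steps = start , λ k k< → ⋀-elim (λ i → stepF C i (suc d′)) steps (∈-range⁺ k<)

  counter : ∀ {d′} → σ ⊨ φd l C d′ → ∀ k → k ≤ l / suc d′ →
    Σ ℕ λ n → n ≤ 2 ℕ.* C × σ ⊨ sv (suc k) (suc d′) (offset C n)
            × offset C n ≡ partialSum x (suc d′) k
  counter {d′} h zero _ =
    C , ℕP.m≤m+n C (C ℕ.+ 0) ,
    subst (λ j → σ ⊨ sv 1 (suc d′) j) (sym (offset-zero C)) (proj₁ (automaton-parts h)) ,
    offset-zero C
  counter {d′} h (suc k) k<l/d with counter h k (ℕP.<⇒≤ k<l/d)
  ... | n , n≤ , at , sum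
    with Automaton.transition σ C (suc k) (suc d′) (proj₂ (automaton-parts h) k k<l/d) B-false n≤ at
  ... | n′ , n′≤ , at′ , moved =
    n′ , n′≤ , at′ , trans (sym moved) (cong (ℤ._+ x (suc k ℕ.* suc d′)) sum)

  discrepancy : DiscAtMost l C x
  discrepancy (suc d′) k _ _ kd≤l with d′ <? D l C
  ... | yes d′<D with counter (automaton-holds d′<D) k (≤-/ k d′ l kd≤l)
  ...   | n , n≤ , _ , sum = subst (λ z → ∣ z ∣ ≤ C) sum (∣offset∣≤ C n≤)
  discrepancy (suc d′) k _ _ kd≤l | no d′≮D =
    ℕP.≤-trans (∣partialSum∣≤ x (∣seqOf∣≤1 σ) (suc d′) k)
               (few-steps l C d′ k (ℕP.≮⇒≥ d′≮D) kd≤l)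

does-true⇒ : ∀ {A : Set} (a? : Dec A) → does a? ≡ true → A
does-true⇒ (yes a) _ = a

module Completeness (l C : ℕ) (x : ℕ → ℤ) (pm : IsPMSeq l x) (disc : DiscAtMost l C x) where

  σc : Assignment
  σc (p i)     = does (x i ℤ.≟ + 1)
  σc B         = false
  σc (s i d j) = does (j ℤ.≟ partialSum x d (i ∸ 1))

  open Rules σc

  counter-value : ∀ i d j → σc ⊨ sv i d j → j ≡ partialSum x d (i ∸ 1)
  counter-value i d j = does-true⇒ (j ℤ.≟ partialSum x d (i ∸ 1))

  sum-bounded : ∀ d′ k → k ℕ.* suc d′ ≤ l → ∣ partialSum x (suc d′) k ∣ ≤ C
  sum-bounded d′ zero    _    = z≤n
  sum-bounded d′ (suc k) kd≤l = disc (suc d′) (suc k) (s≤s z≤n) (s≤s z≤n) kd≤l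

  x-when-p : ∀ i → σc ⊨ pv i → x i ≡ + 1
  x-when-p i = does-true⇒ (x i ℤ.≟ + 1)

  x-when-¬p : ∀ i → 1 ≤ i → i ≤ l → σc ⊨ ¬ᶠ pv i → x i ≡ - + 1
  x-when-¬p i 1≤i i≤l ¬pᵢ with x i ℤ.≟ + 1 | pm i 1≤i i≤l
  ... | no x≢1 | inj₁ x≡1  = ⊥-elim (x≢1 x≡1)
  ... | no _   | inj₂ x≡-1 = x≡-1

  module Position (d′ k : ℕ) (k< : k < l / suc d′) where
    d i : ℕ
    d = suc d′
    i = suc k

    id≤l : i ℕ.* d ≤ l
    id≤l = /-≤ i d′ l k<

    next-sum : ∀ j {e} → σc ⊨ sv i d j → x (i ℕ.* d) ≡ e → j ℤ.+ e ≡ partialSum x d i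
    next-sum j at xe = cong₂ ℤ._+_ (counter-value i d j at) (sym xe)

    Sᵢ-bounded : ∣ partialSum x d i ∣ ≤ C
    Sᵢ-bounded = sum-bounded d′ i id≤l

    up : σc ⊨ countUp C i d
    up = ⋀-intro (λ j → (sv i d j ∧ᶠ pv (i ℕ.* d)) ⇒ᶠ sv (suc i) d (j ℤ.+ + 1)) (lowJ C)
      λ {j} _ → ⇒-intro (sv i d j ∧ᶠ pv (i ℕ.* d)) (sv (suc i) d (j ℤ.+ + 1)) λ h →
        let at , pᵢ = ⊨-∧ (sv i d j) (pv (i ℕ.* d)) h
        in dec-true (_ ℤ.≟ _) (next-sum j at (x-when-p (i ℕ.* d) pᵢ))

    down : σc ⊨ countDown C i d
    down = ⋀-intro (λ j → (sv i d j ∧ᶠ ¬ᶠ pv (i ℕ.* d)) ⇒ᶠ sv (suc i) d (j ℤ.- + 1)) (highJ C)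
      λ {j} _ → ⇒-intro (sv i d j ∧ᶠ ¬ᶠ pv (i ℕ.* d)) (sv (suc i) d (j ℤ.- + 1)) λ h →
        let at , ¬pᵢ = ⊨-∧ (sv i d j) (¬ᶠ pv (i ℕ.* d)) h
        in dec-true (_ ℤ.≟ _) (next-sum j at (x-when-¬p (i ℕ.* d) (s≤s z≤n) id≤l ¬pᵢ))

    -- Passing a wall would make S_i = ±(C+1), contradicting the bound on S_i.
    upper : σc ⊨ upperWall C i d
    upper = ⇒-intro (sv i d (+ C) ∧ᶠ pv (i ℕ.* d)) Bv λ h →
      let at , pᵢ = ⊨-∧ (sv i d (+ C)) (pv (i ℕ.* d)) h
          Sᵢ≡C+1  = next-sum (+ C) at (x-when-p (i ℕ.* d) pᵢ)
      in ⊥-elim (beyond-top C (subst (λ z → ∣ z ∣ ≤ C) (sym Sᵢ≡C+1) Sᵢ-bounded))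

    lower : σc ⊨ lowerWall C i d
    lower = ⇒-intro (sv i d (- + C) ∧ᶠ ¬ᶠ pv (i ℕ.* d)) Bv λ h →
      let at , ¬pᵢ = ⊨-∧ (sv i d (- + C)) (¬ᶠ pv (i ℕ.* d)) h
          Sᵢ≡-C-1  = next-sum (- + C) at (x-when-¬p (i ℕ.* d) (s≤s z≤n) id≤l ¬pᵢ)
      in ⊥-elim (beyond-bottom C (subst (λ z → ∣ z ∣ ≤ C) (sym Sᵢ≡-C-1) Sᵢ-bounded))

    step : σc ⊨ stepF C i d
    step = ∧-intro (countUp C i d) (countDown C i d ∧ᶠ upperWall C i d ∧ᶠ lowerWall C i d) up
          (∧-intro (countDown C i d) (upperWall C i d ∧ᶠ lowerWall C i d) down
          (∧-intro (upperWall C i d) (lowerWall C i d) upper lower))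

    at-most-one : ∀ n m → σc ⊨ pairF C i d n m
    at-most-one n m with n ≡ᵇ m in n≡ᵇm
    ... | true  = refl
    ... | false = ¬-intro (sv i d (offset C n) ∧ᶠ sv i d (offset C m)) λ both →
      let atn , atm = ⊨-∧ (sv i d (offset C n)) (sv i d (offset C m)) both
          n≡m = offset-injective C (trans (counter-value i d (offset C n) atn)
                                          (sym (counter-value i d (offset C m) atm)))
      in subst T n≡ᵇm (ℕP.≡⇒≡ᵇ n m n≡m)

    exactly-one : σc ⊨ exactlyOne C i d
    exactly-one with offset-onto C (partialSum x d k) (sum-bounded d′ k (/-≤ k d′ l (ℕP.<⇒≤ k<)))
    ... | n , n≤ , Sₖ = ∧-intro (atLeastOneF C i d) (atMostOneF C i d)
      (⋁-intro (sv i d) (allJ C) (∈-allJ C n≤) (dec-true (_ ℤ.≟ _) Sₖ))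
      (⋀-intro (λ n → ⋀ (map (pairF C i d n) (upTo (suc (2 ℕ.* C))))) (upTo (suc (2 ℕ.* C)))
        λ {n} _ → ⋀-intro (pairF C i d n) (upTo (suc (2 ℕ.* C))) λ {m} _ → at-most-one n m)

  automaton : ∀ d′ → σc ⊨ φd l C d′
  automaton d′ =
    ∧-intro (sv 1 (suc d′) (+ 0)) (⋀ (map (λ i → stepF C i (suc d′)) (rangeℕ 1 (l / suc d′))))
      (dec-true (+ 0 ℤ.≟ + 0) refl)
      (⋀-intro (λ i → stepF C i (suc d′)) (rangeℕ 1 (l / suc d′))
        (∈-range-elim (λ i → σc ⊨ stepF C i (suc d′)) (Position.step d′)))

  satisfied : σc ⊨ φ l C
  satisfied = ∧-intro (¬ᶠ Bv) (⋀ (map (φd l C) (upTo (D l C))) ∧ᶠ frame l C) refl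
    (∧-intro (⋀ (map (φd l C) (upTo (D l C)))) (frame l C)
      (⋀-intro (φd l C) (upTo (D l C)) λ {d′} _ → automaton d′)
      (⋀-intro (λ d′ → ⋀ (map (λ i → exactlyOne C i (suc d′)) (rangeℕ 1 (l / suc d′))))
               (upTo (D l C)) λ {d′} _ →
        ⋀-intro (λ i → exactlyOne C i (suc d′)) (rangeℕ 1 (l / suc d′))
          (∈-range-elim (λ i → σc ⊨ exactlyOne C i (suc d′)) (Position.exactly-one d′))))

proposition1 : ∀ (l C : ℕ) → 1 ≤ l → 1 ≤ C →
    (Satisfiable (φ l C) ⇔ Σ (ℕ → ℤ) (λ x → IsPMSeq l x × DiscAtMost l C x))
    × (∀ (σ : Assignment) → ⟦ φ l C ⟧ σ ≡ true → DiscAtMost l C (seqOf σ))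
proposition1 l C _ _ = mk⇔ sound complete , Soundness.discrepancy l C
  where
  sound : Satisfiable (φ l C) → Σ (ℕ → ℤ) (λ x → IsPMSeq l x × DiscAtMost l C x)
  sound (σ , σ⊨φ) = seqOf σ , seqOf-pm l σ , Soundness.discrepancy l C σ σ⊨φ

  complete : Σ (ℕ → ℤ) (λ x → IsPMSeq l x × DiscAtMost l C x) → Satisfiable (φ l C)
  complete (x , pm , disc) = Completeness.σc l C x pm disc , Completeness.satisfied l C x pm disc
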